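{- In the setting described in the context, for every statement $G\in\mathcal{E}_{\Gamma(\zeta\vdash E)}$: (1) $J\big((\zeta\vdash E)\wedge J((\zeta\vdash E)\Rightarrow G)\big)\leq_{\Gamma(\zeta\vdash E)} G$; (2) $J\big(E\wedge((\zeta\vdash E)\Rightarrow G)\big)\leq_{\Gamma(\zeta\vdash E)} G$, where $\wedge$ here denotes ordinary conjunction in $\mathcal{E}_\Gamma$.
   Context: Setting. $\Gamma$ is a context (a list of declarations and named assumptions); $\mathcal{E}_\Gamma$ is the meta-set of statements meaningful in $\Gamma$, preordered by deducibility: $A\leq_\Gamma B$ means $B$ can be proved from hypothesis $A$ in context $\Gamma$. $E\in\mathcal{E}_\Gamma$ is a fixed statement and $\Gamma(\zeta\vdash E)$ is the context $\Gamma$ enriched with the assumption named $\zeta$ that $E$ holds; $\mathcal{E}_{\Gamma(\zeta\vdash E)}$ is the preordered meta-set of statements meaningful there, preordered by deducibility $\leq_{\Gamma(\zeta\vdash E)}$. $J=J_{\zeta\vdash E}:\mathcal{E}_\Gamma\to\mathcal{E}_{\Gamma(\zeta\vdash E)}$ is the canonical inclusion; it is monotone. Adjunction: for preorders $X,Y$ and maps $f:X\to Y$, $g:Y\to X$, $f\dashv g$ means $f(x)\leq y\iff x\leq g(y)$ for all $x,y$. Ordinary connectives on $\mathcal{E}_\Gamma$: conjunction $\wedge$ satisfies $A\leq_\Gamma B\wedge C\iff(A\leq_\Gamma B$ and $A\leq_\Gamma C)$; implication satisfies $A\wedge B\leq_\Gamma C\iff A\leq_\Gamma B\Rightarrow C$.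 Dependent connectives: maps $(\zeta\vdash E)\wedge(-)$ and $(\zeta\vdash E)\Rightarrow(-)$ from $\mathcal{E}_{\Gamma(\zeta\vdash E)}$ to $\mathcal{E}_\Gamma$ defined by the adjunctions $(\zeta\vdash E)\wedge(-)\dashv J\dashv(\zeta\vdash E)\Rightarrow(-)$, i.e. $(\zeta\vdash E)\wedge H\leq_\Gamma G\iff H\leq_{\Gamma(\zeta\vdash E)}J(G)$ and $J(F)\leq_{\Gamma(\zeta\vdash E)}H\iff F\leq_\Gamma(\zeta\vdash E)\Rightarrow H$ for $F,G\in\mathcal{E}_\Gamma$, $H\in\mathcal{E}_{\Gamma(\zeta\vdash E)}$. Special rule (postulated): for all $F,G\in\mathcal{E}_\Gamma$, $E\wedge F\leq_\Gamma G\iff J(F)\leq_{\Gamma(\zeta\vdash E)}J(G)$. -}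

module Defs where

open import Level using (Level; suc; _⊔_)
open import Data.Product using (_×_)
open import Function.Bundles using (_⇔_)
open import Relation.Binary.PropositionalEquality using (_≡_)
open import Relation.Binary.Structures using (IsPreorder)

-- X        = 𝓔_Γ                      (statements meaningful in Γ)
--   Y        = 𝓔_{Γ(ζ⊢E)}               (statements meaningful in Γ(ζ⊢E))
--   _≤X_     = ≤_Γ (deducibility),   _≤Y_ = ≤_{Γ(ζ⊢E)}
--   J        = canonical inclusion, monotone
--   E        = the fixed statement E ∈ 𝓔_Γ
--   _∧_,_⇒_  = ordinary conjunction / implication on 𝓔_Γ
--   dAnd     = (ζ⊢E) ∧ (-),  dImp = (ζ⊢E) ⇒ (-), given by dAnd ⊣ J ⊣ dImp
--   special  = postulated special rule
record Setting (a ℓ : Level) : Set (suc (a ⊔ ℓ)) where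
  infix 4 _≤X_ _≤Y_
  infixr 6 _∧_
  infixr 5 _⇒_
  field
    X Y : Set a
    _≤X_ : X → X → Set ℓ
    _≤Y_ : Y → Y → Set ℓ
    ≤X-isPreorder : IsPreorder _≡_ _≤X_
    ≤Y-isPreorder : IsPreorder _≡_ _≤Y_
    J : X → Y
    J-mono : ∀ {A B} → A ≤X B → J A ≤Y J B
    E : X
    _∧_ : X → X → X
    ∧-spec : ∀ A B C → (A ≤X B ∧ C) ⇔ (A ≤X B × A ≤X C)
    _⇒_ : X → X → X
    ⇒-spec : ∀ A B C → (A ∧ B ≤X C) ⇔ (A ≤X B ⇒ C)
    dAnd : Y → X
    dImp : Y → X
    dAnd⊣J : ∀ (H : Y) (G : X) → (dAnd H ≤X G) ⇔ (H ≤Y J G)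
    J⊣dImp : ∀ (F : X) (H : Y) → (J F ≤Y H) ⇔ (F ≤X dImp H)
    special : ∀ (F G : X) → (E ∧ F ≤X G) ⇔ (J F ≤Y J G)

-- Both inequalities say that J sends something below G.
--
--   if F ≤_Γ (ζ⊢E) ⇒ G, then J F ≤_{Γ(ζ⊢E)} G,
--
-- which is the counit J((ζ⊢E) ⇒ G) ≤ G together with monotonicity of J.
-- It then suffices to bound the two arguments of J by (ζ⊢E) ⇒ G:
--   (1) (ζ⊢E) ∧ J F ≤_Γ F, the unit-dual of dAnd ⊣ J at J F ≤ J F;
--   (2) E ∧ F ≤_Γ F, the special rule at J F ≤ J F.
-- Both hold for an arbitrary F ∈ 𝓔_Γ; taking F = (ζ⊢E) ⇒ G gives the theorem.
module Submission where

open import Defs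
open import Level using (Level)
open import Data.Product using (_×_; _,_)
open import Function.Bundles using (Equivalence)
open import Relation.Binary.Structures using (IsPreorder)

module _ {a ℓ : Level} (S : Setting a ℓ) where
  open Setting S
  open Equivalence

  private
    reflX : ∀ {A} → A ≤X A
    reflX = IsPreorder.refl ≤X-isPreorder

    reflY : ∀ {H} → H ≤Y H
    reflY = IsPreorder.refl ≤Y-isPreorder

    transY : ∀ {H K L} → H ≤Y K → K ≤Y L → H ≤Y L
    transY = IsPreorder.trans ≤Y-isPreorder

  J-dImp-counit : ∀ (G : Y) → J (dImp G) ≤Y G
  J-dImp-counit G = from (J⊣dImp (dImp G) G) reflX

  J-below : ∀ {F : X} (G : Y) → F ≤X dImp G → J F ≤Y G
  J-below G F≤dImpG = transY (J-mono F≤dImpG) (J-dImp-counit G)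

  dAnd-J-counit : ∀ (F : X) → dAnd (J F) ≤X F
  dAnd-J-counit F = from (dAnd⊣J (J F) F) reflY

  E∧-deflationary : ∀ (F : X) → E ∧ F ≤X F
  E∧-deflationary F = from (special F F) reflY

mainTheorem2 : ∀ {a ℓ} (S : Setting a ℓ) → let open Setting S in
    ∀ (G : Y) →
    (J (dAnd (J (dImp G))) ≤Y G) × (J (E ∧ dImp G) ≤Y G)
mainTheorem2 S G =
    J-below S G (dAnd-J-counit S (dImp G))
  , J-below S G (E∧-deflationary S (dImp G))
  where open Setting S using (dImp)
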